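{- Let $g,h$ be distinct free generators of the free group $F(g,h)$, and for $n\ge1$ let $u_n=[g,h]_n$ be the freely reduced word defined by $[g,h]_1=gh^{ -1}g^{ -1}h$ and $[g,h]_n=[g,[g,h]_{n-1}]_1$ (after free reduction). Then for all $n\ge1$, every cyclic subword of $u_n$ of length at least four is magic in $g$ and $h$.
   Context: A cyclic permutation of a word $a_1\dots a_m$ is a word $a_k\dots a_m a_1\dots a_{k-1}$ for some $k$. A word $v$ is a cyclic subword of $w$ if $v$ or $v^{ -1}$ is a (contiguous) subword of some cyclic permutation of $w$. A word $u$ is magic in $g$ and $h$ if $u$ and $u^{ -1}$ together contain at least three of the four words $gh$, $hg$, $g^{ -1}h$, $hg^{ -1}$ as contiguous subwords. -}

module Defs where

open import Data.Nat using (ℕ; zero; suc)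
open import Data.Bool using (Bool; true; false; if_then_else_)
open import Data.List using (List; []; _∷_; _++_; reverse; map; foldr; take; drop; length)
open import Data.Product using (_×_; ∃; ∃-syntax; _,_)
open import Data.Sum using (_⊎_)
open import Relation.Binary.PropositionalEquality using (_≡_)
open import Data.Nat using (_<_)

data Letter : Set where
  g⁺ g⁻ h⁺ h⁻ : Letter

Word : Set
Word = List Letter

invL : Letter → Letter
invL g⁺ = g⁻
invL g⁻ = g⁺
invL h⁺ = h⁻
invL h⁻ = h⁺

inv : Word → Word
inv w = reverse (map invL w)

cancels : Letter → Letter → Bool
cancels g⁺ g⁻ = true
cancels g⁻ g⁺ = true
cancels h⁺ h⁻ = true
cancels h⁻ h⁺ = true
cancels _  _  = false

push : Letter → Word → Word
push x []       = x ∷ []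
push x (y ∷ ys) = if cancels x y then ys else x ∷ y ∷ ys

reduce : Word → Word
reduce = foldr push []

-- iterated commutator: bracket 0 = h, bracket (n+1) = [g, bracket n]_1
-- where [g,x]_1 = g x⁻¹ g⁻¹ x (freely reduced).  Hence bracket 1 = g h⁻¹ g⁻¹ h,
-- and bracket n = [g,h]_n for n ≥ 1.
bracket : ℕ → Word
bracket zero    = h⁺ ∷ []
bracket (suc n) = reduce (g⁺ ∷ inv (bracket n) ++ g⁻ ∷ bracket n)

Subword : Word → Word → Set
Subword v w = ∃[ p ] ∃[ s ] (p ++ v ++ s ≡ w)

CyclicPerm : Word → Word → Set
CyclicPerm c w = (w ≡ [] × c ≡ []) ⊎ (∃[ k ] (k < length w × c ≡ drop k w ++ take k w))

CyclicSubword : Word → Word → Set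
CyclicSubword v w = ∃[ c ] (CyclicPerm c w × (Subword v c ⊎ Subword (inv v) c))

Contains : Word → Word → Set
Contains u x = Subword x u ⊎ Subword x (inv u)

gh hg g⁻¹h hg⁻¹ : Word
gh    = g⁺ ∷ h⁺ ∷ []
hg    = h⁺ ∷ g⁺ ∷ []
g⁻¹h  = g⁻ ∷ h⁺ ∷ []
hg⁻¹  = h⁺ ∷ g⁻ ∷ []

-- u is magic in g and h: u and u⁻¹ together contain at least three of the four words
Magic : Word → Set
Magic u =
    (Contains u gh × Contains u hg × Contains u g⁻¹h)
  ⊎ (Contains u gh × Contains u hg × Contains u hg⁻¹)
  ⊎ (Contains u gh × Contains u g⁻¹h × Contains u hg⁻¹)
  ⊎ (Contains u hg × Contains u g⁻¹h × Contains u hg⁻¹)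

{-# OPTIONS --safe #-}

-- Put body₀ = h⁻¹g⁻¹h and body_{n+1} = body_n⁻¹ g⁻¹ body_n.  Then [g,h]_{n+1} = g body_n:
-- unfolding the definition gives g body_n⁻¹ g⁻¹ g⁻¹ g body_n, and the pair g⁻¹ g is the only
-- cancellation.  Hence, read cyclically, [g,h]_n follows the pattern  … h⁻¹ g^± h g^± h⁻¹ …
-- in which g- and h-letters alternate and the h-letters alternate in sign.  Every cyclic
-- subword lies in u_n u_n and so follows the same pattern.  In a window of four letters of this
-- pattern, the triple h^∓ g^± h^± together with its inverse supplies both of gh, g⁻¹h or both
-- of hg, hg⁻¹, and the remaining adjacent pair supplies one of the other two; so the window is
-- magic, and magic words stay magic in longer words.

module Submission where

open import Defs
open import Data.Nat using (ℕ; zero; suc; _≤_; s≤s)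
open import Data.Bool using (true; false)
open import Data.List using ([]; _∷_; _++_; length; reverse; map; foldr; take; drop)
open import Data.List.Properties
  using (++-assoc; reverse-++; reverse-map; reverse-involutive; map-++; map-∘; map-cong; map-id;
         foldr-++; take++drop≡id; length-reverse; length-map)
open import Data.List.Relation.Unary.Linked using (Linked; []; [-]; _∷_; tail)
open import Data.List.Relation.Binary.Pointwise using (Pointwise-≡⇒≡; ≡⇒Pointwise-≡)
open import Data.List.Relation.Binary.Infix.Heterogeneous using (Infix; MkView; toView; fromView)
open import Data.List.Relation.Binary.Infix.Heterogeneous.Properties using (infix?)
open import Data.Product using (_×_; ∃-syntax; _,_)
open import Data.Sum using (inj₁; inj₂)
open import Function using (_∘_)
open import Relation.Nullary using (Dec; yes; no)
open import Relation.Nullary.Decidable using (True; toWitness; map′; _×-dec_; _⊎-dec_)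
open import Relation.Binary.Definitions using (DecidableEquality)
open import Relation.Binary.PropositionalEquality
  using (_≡_; refl; sym; trans; cong; cong₂; subst; module ≡-Reasoning)
open ≡-Reasoning

invL-involutive : ∀ x → invL (invL x) ≡ x
invL-involutive g⁺ = refl
invL-involutive g⁻ = refl
invL-involutive h⁺ = refl
invL-involutive h⁻ = refl

inv-++ : ∀ u w → inv (u ++ w) ≡ inv w ++ inv u
inv-++ u w = trans (cong reverse (map-++ invL u w)) (reverse-++ (map invL u) (map invL w))

inv-involutive : ∀ w → inv (inv w) ≡ w
inv-involutive w = begin
  reverse (map invL (reverse (map invL w)))  ≡⟨ cong reverse (reverse-map invL (map invL w)) ⟩
  reverse (reverse (map invL (map invL w)))  ≡⟨ reverse-involutive _ ⟩
  map invL (map invL w)                      ≡⟨ map-∘ w ⟨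
  map (invL ∘ invL) w                        ≡⟨ map-cong invL-involutive w ⟩
  map (λ x → x) w                            ≡⟨ map-id w ⟩
  w                                          ∎

length-inv : ∀ w → length (inv w) ≡ length w
length-inv w = trans (length-reverse (map invL w)) (length-map invL w)

inv-∷ : ∀ x w → inv (x ∷ w) ≡ inv w ++ invL x ∷ []
inv-∷ x w = inv-++ (x ∷ []) w

subword-trans : ∀ {u v w} → Subword u v → Subword v w → Subword u w
subword-trans {u} (p , s , refl) (p′ , s′ , refl) = p′ ++ p , s ++ s′ , (begin
  (p′ ++ p) ++ u ++ s ++ s′    ≡⟨ ++-assoc p′ p (u ++ s ++ s′) ⟩
  p′ ++ p ++ u ++ s ++ s′      ≡⟨ cong (λ t → p′ ++ p ++ t) (++-assoc u s s′) ⟨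
  p′ ++ p ++ (u ++ s) ++ s′    ≡⟨ cong (p′ ++_) (++-assoc p (u ++ s) s′) ⟨
  p′ ++ (p ++ u ++ s) ++ s′    ∎)

subword-inv : ∀ {u w} → Subword u w → Subword (inv u) (inv w)
subword-inv {u} (p , s , refl) = inv s , inv p , (begin
  inv s ++ inv u ++ inv p      ≡⟨ ++-assoc (inv s) (inv u) (inv p) ⟨
  (inv s ++ inv u) ++ inv p    ≡⟨ cong (_++ inv p) (inv-++ u s) ⟨
  inv (u ++ s) ++ inv p        ≡⟨ inv-++ p (u ++ s) ⟨
  inv (p ++ u ++ s)            ∎)

magic-map : ∀ {u w} → (∀ {x} → Contains u x → Contains w x) → Magic u → Magic w
magic-map f (inj₁ (a , b , c))                = inj₁ (f a , f b , f c)
magic-map f (inj₂ (inj₁ (a , b , c)))         = inj₂ (inj₁ (f a , f b , f c))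
magic-map f (inj₂ (inj₂ (inj₁ (a , b , c))))  = inj₂ (inj₂ (inj₁ (f a , f b , f c)))
magic-map f (inj₂ (inj₂ (inj₂ (a , b , c))))  = inj₂ (inj₂ (inj₂ (f a , f b , f c)))

magic-subword : ∀ {u w} → Subword u w → Magic u → Magic w
magic-subword u⊑w = magic-map λ where
  (inj₁ x⊑u)   → inj₁ (subword-trans x⊑u u⊑w)
  (inj₂ x⊑u⁻¹) → inj₂ (subword-trans x⊑u⁻¹ (subword-inv u⊑w))

magic-inv : ∀ {u} → Magic (inv u) → Magic u
magic-inv {u} = magic-map λ where
  (inj₁ x⊑u⁻¹)   → inj₂ x⊑u⁻¹
  (inj₂ x⊑u⁻¹⁻¹) → inj₁ (subst (Subword _) (inv-involutive u) x⊑u⁻¹⁻¹)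

_≟_ : DecidableEquality Letter
g⁺ ≟ g⁺ = yes refl
g⁺ ≟ g⁻ = no λ ()
g⁺ ≟ h⁺ = no λ ()
g⁺ ≟ h⁻ = no λ ()
g⁻ ≟ g⁺ = no λ ()
g⁻ ≟ g⁻ = yes refl
g⁻ ≟ h⁺ = no λ ()
g⁻ ≟ h⁻ = no λ ()
h⁺ ≟ g⁺ = no λ ()
h⁺ ≟ g⁻ = no λ ()
h⁺ ≟ h⁺ = yes refl
h⁺ ≟ h⁻ = no λ ()
h⁻ ≟ g⁺ = no λ ()
h⁻ ≟ g⁻ = no λ ()
h⁻ ≟ h⁺ = no λ ()
h⁻ ≟ h⁻ = yes refl

infix⇒subword : ∀ {v w} → Infix _≡_ v w → Subword v w
infix⇒subword i with MkView p v≋ s ← toView i = p , s , cong (λ t → p ++ t ++ s) (Pointwise-≡⇒≡ v≋)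

subword⇒infix : ∀ {v w} → Subword v w → Infix _≡_ v w
subword⇒infix (p , s , refl) = fromView (MkView p (≡⇒Pointwise-≡ refl) s)

subword? : ∀ v w → Dec (Subword v w)
subword? v w = map′ infix⇒subword subword⇒infix (infix? _≟_ v w)

contains? : ∀ u x → Dec (Contains u x)
contains? u x = subword? x u ⊎-dec subword? x (inv u)

magic? : ∀ u → Dec (Magic u)
magic? u =   (c gh ×-dec c hg ×-dec c g⁻¹h)
      ⊎-dec (c gh ×-dec c hg ×-dec c hg⁻¹)
      ⊎-dec (c gh ×-dec c g⁻¹h ×-dec c hg⁻¹)
      ⊎-dec (c hg ×-dec c g⁻¹h ×-dec c hg⁻¹)
  where
  c : ∀ x → Dec (Contains u x)
  c = contains? u

Reduced : Word → Set
Reduced = Linked (λ x y → cancels x y ≡ false)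

cancels-invL : ∀ x → cancels x (invL x) ≡ true
cancels-invL g⁺ = refl
cancels-invL g⁻ = refl
cancels-invL h⁺ = refl
cancels-invL h⁻ = refl

push-invL : ∀ x w → push x (invL x ∷ w) ≡ w
push-invL x w rewrite cancels-invL x = refl

push-reduced : ∀ {x w} → Reduced (x ∷ w) → push x w ≡ x ∷ w
push-reduced [-]                   = refl
push-reduced (x≁y ∷ _) rewrite x≁y = refl

reduced⇒reduce-id : ∀ {w} → Reduced w → reduce w ≡ w
reduced⇒reduce-id {[]}    _           = refl
reduced⇒reduce-id {x ∷ w} x∷w-reduced =
  trans (cong (push x) (reduced⇒reduce-id (tail x∷w-reduced))) (push-reduced x∷w-reduced)

reduce-cancel : ∀ u x w → Reduced (invL x ∷ w) → reduce (u ++ x ∷ invL x ∷ w) ≡ reduce (u ++ w)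
reduce-cancel u x w x⁻¹w-reduced = begin
  reduce (u ++ x ∷ invL x ∷ w)                      ≡⟨ foldr-++ push [] u (x ∷ invL x ∷ w) ⟩
  foldr push (push x (push (invL x) (reduce w))) u  ≡⟨ cong (λ t → foldr push t u) pushes-cancel ⟩
  foldr push (reduce w) u                           ≡⟨ foldr-++ push [] u w ⟨
  reduce (u ++ w)                                   ∎
  where
  pushes-cancel : push x (push (invL x) (reduce w)) ≡ reduce w
  pushes-cancel rewrite reduced⇒reduce-id (tail x⁻¹w-reduced) =
    trans (cong (push x) (push-reduced x⁻¹w-reduced)) (push-invL x w)

-- Automaton for the subwords of  … h⁻¹ g^± h g^± h⁻¹ …  : in phase  at η  the next letter is the
-- h-letter η, in phase  before η  it is a g-letter followed by η.
data Phase : Set where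
  at before : Letter → Phase

data Step : Phase → Letter → Phase → Set where
  h⁺-step : Step (at h⁺) h⁺ (before h⁻)
  h⁻-step : Step (at h⁻) h⁻ (before h⁺)
  g⁺-step : ∀ {η} → Step (before η) g⁺ (at η)
  g⁻-step : ∀ {η} → Step (before η) g⁻ (at η)

infixr 5 _∷_

data Run : Phase → Word → Phase → Set where
  []  : ∀ {p} → Run p [] p
  _∷_ : ∀ {p q r x w} → Step p x q → Run q w r → Run p (x ∷ w) r

Zigzag : Word → Set
Zigzag w = ∃[ p ] ∃[ q ] Run p w q

run-++⁺ : ∀ {p q r u v} → Run p u q → Run q v r → Run p (u ++ v) r
run-++⁺ []       ρ  = ρ
run-++⁺ (σ ∷ ρ₁) ρ₂ = σ ∷ run-++⁺ ρ₁ ρ₂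

run-++⁻ : ∀ {p r v} u → Run p (u ++ v) r → ∃[ q ] (Run p u q × Run q v r)
run-++⁻ []      ρ       = _ , [] , ρ
run-++⁻ (x ∷ u) (σ ∷ ρ) with q , ρ₁ , ρ₂ ← run-++⁻ u ρ = q , σ ∷ ρ₁ , ρ₂

zigzag-subword : ∀ {v w} → Subword v w → Zigzag w → Zigzag v
zigzag-subword {v} (p , s , refl) (_ , _ , ρ)
  with _ , _ , ρ′ ← run-++⁻ p ρ
  with _ , ρ″ , _ ← run-++⁻ v ρ′ = _ , _ , ρ″

magic?-accepts-window : ∀ {p q a b c d} →
                        Run p (a ∷ b ∷ c ∷ d ∷ []) q → True (magic? (a ∷ b ∷ c ∷ d ∷ []))
magic?-accepts-window (h⁺-step ∷ g⁺-step ∷ h⁻-step ∷ g⁺-step ∷ []) = _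
magic?-accepts-window (h⁺-step ∷ g⁺-step ∷ h⁻-step ∷ g⁻-step ∷ []) = _
magic?-accepts-window (h⁺-step ∷ g⁻-step ∷ h⁻-step ∷ g⁺-step ∷ []) = _
magic?-accepts-window (h⁺-step ∷ g⁻-step ∷ h⁻-step ∷ g⁻-step ∷ []) = _
magic?-accepts-window (h⁻-step ∷ g⁺-step ∷ h⁺-step ∷ g⁺-step ∷ []) = _
magic?-accepts-window (h⁻-step ∷ g⁺-step ∷ h⁺-step ∷ g⁻-step ∷ []) = _
magic?-accepts-window (h⁻-step ∷ g⁻-step ∷ h⁺-step ∷ g⁺-step ∷ []) = _
magic?-accepts-window (h⁻-step ∷ g⁻-step ∷ h⁺-step ∷ g⁻-step ∷ []) = _
magic?-accepts-window (g⁺-step ∷ h⁺-step ∷ g⁺-step ∷ h⁻-step ∷ []) = _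
magic?-accepts-window (g⁺-step ∷ h⁺-step ∷ g⁻-step ∷ h⁻-step ∷ []) = _
magic?-accepts-window (g⁻-step ∷ h⁺-step ∷ g⁺-step ∷ h⁻-step ∷ []) = _
magic?-accepts-window (g⁻-step ∷ h⁺-step ∷ g⁻-step ∷ h⁻-step ∷ []) = _
magic?-accepts-window (g⁺-step ∷ h⁻-step ∷ g⁺-step ∷ h⁺-step ∷ []) = _
magic?-accepts-window (g⁺-step ∷ h⁻-step ∷ g⁻-step ∷ h⁺-step ∷ []) = _
magic?-accepts-window (g⁻-step ∷ h⁻-step ∷ g⁺-step ∷ h⁺-step ∷ []) = _
magic?-accepts-window (g⁻-step ∷ h⁻-step ∷ g⁻-step ∷ h⁺-step ∷ []) = _

zigzag-magic : ∀ {v} → Zigzag v → 4 ≤ length v → Magic v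
zigzag-magic {a ∷ b ∷ c ∷ d ∷ r} (_ , _ , ρ) _
  with _ , window , _ ← run-++⁻ (a ∷ b ∷ c ∷ d ∷ []) ρ =
  magic-subword ([] , r , refl) (toWitness (magic?-accepts-window window))
zigzag-magic {_ ∷ []}           _ (s≤s ())
zigzag-magic {_ ∷ _ ∷ []}       _ (s≤s (s≤s ()))
zigzag-magic {_ ∷ _ ∷ _ ∷ []}   _ (s≤s (s≤s (s≤s ())))

steps-noncancelling : ∀ {p q r x y} → Step p x q → Step q y r → cancels x y ≡ false
steps-noncancelling h⁺-step g⁺-step = refl
steps-noncancelling h⁺-step g⁻-step = refl
steps-noncancelling h⁻-step g⁺-step = refl
steps-noncancelling h⁻-step g⁻-step = refl
steps-noncancelling g⁺-step h⁺-step = refl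
steps-noncancelling g⁺-step h⁻-step = refl
steps-noncancelling g⁻-step h⁺-step = refl
steps-noncancelling g⁻-step h⁻-step = refl

run-reduced : ∀ {p q w} → Run p w q → Reduced w
run-reduced []          = []
run-reduced (σ ∷ [])    = [-]
run-reduced (σ ∷ τ ∷ ρ) = steps-noncancelling σ τ ∷ run-reduced (τ ∷ ρ)

body body⁻¹ : ℕ → Word
body zero      = h⁻ ∷ g⁻ ∷ h⁺ ∷ []
body (suc n)   = body⁻¹ n ++ g⁻ ∷ body n
body⁻¹ zero    = h⁻ ∷ g⁺ ∷ h⁺ ∷ []
body⁻¹ (suc n) = body⁻¹ n ++ g⁺ ∷ body n

inv-body : ∀ n → inv (body n) ≡ body⁻¹ n
inv-body zero    = refl
inv-body (suc n) = begin
  inv (body⁻¹ n ++ g⁻ ∷ body n)                  ≡⟨ inv-++ (body⁻¹ n) (g⁻ ∷ body n) ⟩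
  inv (g⁻ ∷ body n) ++ inv (body⁻¹ n)            ≡⟨ cong (_++ inv (body⁻¹ n)) (inv-∷ g⁻ (body n)) ⟩
  (inv (body n) ++ g⁺ ∷ []) ++ inv (body⁻¹ n)    ≡⟨ cong₂ (λ s t → (s ++ g⁺ ∷ []) ++ t) (inv-body n) inv-body⁻¹ ⟩
  (body⁻¹ n ++ g⁺ ∷ []) ++ body n                ≡⟨ ++-assoc (body⁻¹ n) (g⁺ ∷ []) (body n) ⟩
  body⁻¹ n ++ g⁺ ∷ body n                        ∎
  where
  inv-body⁻¹ : inv (body⁻¹ n) ≡ body n
  inv-body⁻¹ = trans (cong inv (sym (inv-body n))) (inv-involutive (body n))

body-run   : ∀ n → Run (at h⁻) (body n) (before h⁻)
body⁻¹-run : ∀ n → Run (at h⁻) (body⁻¹ n) (before h⁻)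
body-run zero      = h⁻-step ∷ g⁻-step ∷ h⁺-step ∷ []
body-run (suc n)   = run-++⁺ (body⁻¹-run n) (g⁻-step ∷ body-run n)
body⁻¹-run zero    = h⁻-step ∷ g⁺-step ∷ h⁺-step ∷ []
body⁻¹-run (suc n) = run-++⁺ (body⁻¹-run n) (g⁺-step ∷ body-run n)

bracket-body : ∀ n → bracket (suc n) ≡ g⁺ ∷ body n
bracket-body zero    = refl
bracket-body (suc n) = begin
  reduce (g⁺ ∷ inv (bracket (suc n)) ++ g⁻ ∷ bracket (suc n))
    ≡⟨ cong (λ b → reduce (g⁺ ∷ inv b ++ g⁻ ∷ b)) (bracket-body n) ⟩
  reduce (g⁺ ∷ inv (g⁺ ∷ body n) ++ g⁻ ∷ g⁺ ∷ body n)
    ≡⟨ cong (λ t → reduce (g⁺ ∷ t ++ g⁻ ∷ g⁺ ∷ body n)) inv-g⁺∷body ⟩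
  reduce ((g⁺ ∷ body⁻¹ n ++ g⁻ ∷ []) ++ g⁻ ∷ g⁺ ∷ body n)
    ≡⟨ reduce-cancel (g⁺ ∷ body⁻¹ n ++ g⁻ ∷ []) g⁻ (body n) (run-reduced (g⁺-step ∷ body-run n)) ⟩
  reduce ((g⁺ ∷ body⁻¹ n ++ g⁻ ∷ []) ++ body n)
    ≡⟨ cong (reduce ∘ (g⁺ ∷_)) (++-assoc (body⁻¹ n) (g⁻ ∷ []) (body n)) ⟩
  reduce (g⁺ ∷ body (suc n))
    ≡⟨ reduced⇒reduce-id (run-reduced (g⁺-step ∷ body-run (suc n))) ⟩
  g⁺ ∷ body (suc n)
    ∎
  where
  inv-g⁺∷body : inv (g⁺ ∷ body n) ≡ body⁻¹ n ++ g⁻ ∷ []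
  inv-g⁺∷body = trans (inv-∷ g⁺ (body n)) (cong (_++ g⁻ ∷ []) (inv-body n))

bracket-run : ∀ n → Run (before h⁻) (bracket (suc n)) (before h⁻)
bracket-run n =
  subst (λ w → Run (before h⁻) w (before h⁻)) (sym (bracket-body n)) (g⁺-step ∷ body-run n)

cyclicPerm⇒subword-doubled : ∀ {c w} → CyclicPerm c w → Subword c (w ++ w)
cyclicPerm⇒subword-doubled (inj₁ (refl , refl))            = [] , [] , refl
cyclicPerm⇒subword-doubled {w = w} (inj₂ (k , _ , refl)) = take k w , drop k w , (begin
  take k w ++ (drop k w ++ take k w) ++ drop k w
    ≡⟨ cong (take k w ++_) (++-assoc (drop k w) (take k w) (drop k w)) ⟩
  take k w ++ drop k w ++ take k w ++ drop k w
    ≡⟨ ++-assoc (take k w) (drop k w) (take k w ++ drop k w) ⟨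
  (take k w ++ drop k w) ++ take k w ++ drop k w
    ≡⟨ cong₂ _++_ (take++drop≡id k w) (take++drop≡id k w) ⟩
  w ++ w
    ∎)

loop-cyclicPerm-zigzag : ∀ {p w c} → Run p w p → CyclicPerm c w → Zigzag c
loop-cyclicPerm-zigzag ρ c-perm = zigzag-subword (cyclicPerm⇒subword-doubled c-perm) (_ , _ , run-++⁺ ρ ρ)

lemma3p14 : (n : ℕ) → 1 ≤ n → (v : Word) → CyclicSubword v (bracket n) → 4 ≤ length v → Magic v
lemma3p14 (suc n) _ v (_ , c-perm , inj₁ v⊑c) 4≤|v| =
  zigzag-magic (zigzag-subword v⊑c (loop-cyclicPerm-zigzag (bracket-run n) c-perm)) 4≤|v|
lemma3p14 (suc n) _ v (_ , c-perm , inj₂ v⁻¹⊑c) 4≤|v| =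
  magic-inv (zigzag-magic (zigzag-subword v⁻¹⊑c (loop-cyclicPerm-zigzag (bracket-run n) c-perm))
                          (subst (4 ≤_) (sym (length-inv v)) 4≤|v|))
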